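{- For every tree $T$ with at least $2$ vertices and every vertex $v\in V(T)$, \[ I(T-v;-1)\cdot I(T-N[v];-1)\in\{0,1\}\quad\text{and}\quad I(T;-1)\cdot I(T-v;-1)\in\{0,1\}. \]
   Context: A tree is a connected acyclic finite graph. A stable set is a set of pairwise non-adjacent vertices; if $s_k$ is the number of stable sets of size $k$ (with $s_0=1$), $I(G;x)=\sum_k s_kx^k$ is the independence polynomial (equal to $1$ for the graph with no vertices). $N[v]$ is $v$ together with its neighbors; $T-W$ denotes the subgraph induced on $V(T)\setminus W$, and $T-v=T-\{v\}$. -}

module Defs where

open import Data.Nat using (ℕ; zero; suc; _≤_)
open import Data.Bool using (Bool; true; false; _∨_)
open import Data.Fin using (Fin; zero; suc; inject₁; fromℕ; _≟_)
open import Data.Fin.Properties using (all?)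
open import Data.Fin.Subset using (Subset; ⊤; _∈_; _⊆_; ∁; ∣_∣; inside; outside)
open import Data.Fin.Subset.Properties using (_∈?_; _⊆?_)
open import Data.Vec using (tabulate; _∷_; [])
open import Data.List using (List; []; _∷_; map; filter; _++_)
open import Data.Integer using (ℤ; +_; -_; _^_; _*_)
open import Data.Integer.Base using (_+_)
open import Data.Product using (_×_; _,_)
open import Relation.Binary.PropositionalEquality using (_≡_; refl)
open import Relation.Nullary using (¬_; Dec; yes; no)
open import Relation.Nullary.Decidable using (⌊_⌋; ¬?; _×-dec_)
open import Function.Definitions using (Injective)
open import Data.Bool.Properties using () renaming (_≟_ to _≟B_)

record Graph (n : ℕ) : Set where
  field
    adj    : Fin n → Fin n → Bool
    sym    : ∀ u v → adj u v ≡ adj v u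
    irrefl : ∀ v → adj v v ≡ false
open Graph public

module _ {n : ℕ} (G : Graph n) where

  Adj : Fin n → Fin n → Set
  Adj u v = adj G u v ≡ true

  Adj? : ∀ u v → Dec (Adj u v)
  Adj? u v = adj G u v ≟B true

  data Walk : Fin n → Fin n → Set where
    [] : ∀ {v} → Walk v v
    _∷_ : ∀ {u w v} → Adj u w → Walk w v → Walk u v

  Connected : Set
  Connected = ∀ u v → Walk u v

  -- a cycle of length m+3: distinct vertices f 0, …, f (m+2), consecutive ones
  -- adjacent and f (m+2) adjacent to f 0
  IsCycle : (m : ℕ) → (Fin (suc (suc (suc m))) → Fin n) → Set
  IsCycle m f = Injective _≡_ _≡_ f
              × (∀ (i : Fin (suc (suc m))) → Adj (f (inject₁ i)) (f (suc i)))
              × Adj (f (fromℕ (suc (suc m)))) (f zero)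

  Acyclic : Set
  Acyclic = ∀ m f → ¬ IsCycle m f

  IsTree : Set
  IsTree = Connected × Acyclic

  Stable : Subset n → Set
  Stable S = ∀ u v → u ∈ S → v ∈ S → ¬ Adj u v

  Stable? : ∀ S → Dec (Stable S)
  Stable? S = all? λ u → all? λ v →
    Dec-imp (u ∈? S) (Dec-imp (v ∈? S) (¬? (Adj? u v)))
    where
    Dec-imp : ∀ {A B : Set} → Dec A → Dec B → Dec (A → B)
    Dec-imp _       (yes b) = yes (λ _ → b)
    Dec-imp (no ¬a) _       = yes (λ a → Data.Empty.⊥-elim (¬a a))
      where import Data.Empty
    Dec-imp (yes a) (no ¬b) = no (λ f → ¬b (f a))

  closedNbhd : Fin n → Subset n
  closedNbhd v = tabulate λ u → ⌊ u ≟ v ⌋ ∨ adj G v u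

allSubsets : ∀ n → List (Subset n)
allSubsets zero = [] ∷ []
allSubsets (suc n) = map (outside ∷_) (allSubsets n) ++ map (inside ∷_) (allSubsets n)

sumℤ : List ℤ → ℤ
sumℤ [] = + 0
sumℤ (x ∷ xs) = x + sumℤ xs

-- I(G[U]; x): independence polynomial of the subgraph of G induced on U,
-- evaluated at x.  Stable sets of G[U] are exactly the stable sets of G
-- contained in U.
indPolyOn : ∀ {n} → Graph n → Subset n → ℤ → ℤ
indPolyOn {n} G U x =
  sumℤ (map (λ S → x ^ ∣ S ∣)
            (filter (λ S → (S ⊆? U) ×-dec Stable? G S) (allSubsets n)))

indPolyMinus : ∀ {n} → Graph n → Subset n → ℤ → ℤ
indPolyMinus G W x = indPolyOn G (∁ W) x

indPoly : ∀ {n} → Graph n → ℤ → ℤ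
indPoly G x = indPolyOn G ⊤ x

-- Deleting a vertex v gives I(G; x) = I(G − v; x) + x · I(G − N[v]; x).  In a
-- forest, every nonempty induced subgraph F has a vertex u with at most one
-- neighbour in F.  At x = −1 the recurrence gives I(F; −1) = 0 if u is isolated
-- in F, and I(F; −1) = −I(F − u − N[w]; −1) if w is the neighbour of u, so by
-- induction I(F; −1) ∈ {−1, 0, 1}.  The recurrence at v then reads
-- I(T) = I(T − v) − I(T − N[v]) with all three values in {−1, 0, 1}, which leaves
-- no room for a product equal to −1.

module Submission where

open import Algebra.Properties.CommutativeSemigroup using (interchange)
open import Data.Bool using (true; false; if_then_else_; _∨_)
open import Data.Fin using (Fin; zero; suc; toℕ; inject₁; inject≤; fromℕ; _≟_)
open import Data.Fin.Properties using (any?; toℕ-injective; toℕ-inject≤; toℕ-inject₁; inject≤-injective; toℕ≤pred[n]; toℕ-fromℕ; toℕ<n; injective⇒≤)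
open import Data.Fin.Subset using (Subset; inside; outside; _∈_; _∉_; _⊆_; _⊂_; _─_; _-_; ∁; ⊤; ⊥; ⁅_⁆; ∣_∣; Nonempty)
open import Data.Fin.Subset.Induction using (Acc; acc; ⊂-wellFounded)
open import Data.Fin.Subset.Properties using (_∈?_; _⊆?_; ⊆-antisym; ⊆-⊂-trans; p─q⊆p; x∈p∧x∉q⇒x∈p─q; x∈p⇒p-x⊂p; x∈p∧x≢y⇒x∈p-y; x∈⁅x⁆; x∈⁅y⁆⇒x≡y; ∉⊥; ⊥⊆; ∣⊥∣≡0; nonempty?; Empty-unique; ∈⊤)
open import Data.Integer using (ℤ; +_; 0ℤ; 1ℤ; -1ℤ; _+_; _*_; -_; _^_)
open import Data.Integer.Solver using (module +-*-Solver)
open import Data.Integer.Properties using (+-identityˡ; +-identityʳ; +-assoc; +-commutativeSemigroup; *-zeroʳ; *-distribˡ-+; -1*i≡-i)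
open import Data.List using (List; []; _∷_; map; filter; _++_)
open import Data.List.Properties using (map-++; map-∘)
open import Data.Nat using (ℕ; zero; suc; _≤_) renaming (_+_ to _+ℕ_)
open import Data.Nat.Properties using (m≤m+n; <⇒≱; +-suc)
open import Data.Product using (∃; ∃₂; _×_; _,_)
open import Data.Sum using (_⊎_; inj₁; inj₂; [_,_]′)
open import Data.Vec using ([]; _∷_; here; there; _[_]≔_)
open import Data.Vec.Properties using ([]=⇒lookup; lookup⇒[]=; lookup∘tabulate; []≔-updates; []≔-minimal; lookup∘update′)
open import Function using (_∘_; _⇔_; mk⇔; Equivalence)
open import Function.Definitions using (Injective)
open import Relation.Binary.PropositionalEquality using (_≡_; _≢_; refl; sym; trans; cong; cong₂; subst; module ≡-Reasoning)
open import Relation.Nullary using (¬_; Dec; yes; no; does; contradiction)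
open import Relation.Nullary.Decidable using (⌊_⌋; ¬?; _×-dec_; dec-true; dec-false)
open import Relation.Unary using (Decidable)

open import Defs hiding (sym)
open +-*-Solver using (solve; _:+_; _:*_; _:=_; con)

private
  variable
    n k : ℕ

∑ : ∀ n → (Subset n → ℤ) → ℤ
∑ zero    h = h []
∑ (suc n) h = ∑ n (λ S → h (outside ∷ S)) + ∑ n (λ S → h (inside ∷ S))

sumℤ-++ : ∀ (xs ys : List ℤ) → sumℤ (xs ++ ys) ≡ sumℤ xs + sumℤ ys
sumℤ-++ []       ys = sym (+-identityˡ (sumℤ ys))
sumℤ-++ (x ∷ xs) ys = trans (cong (_+_ x) (sumℤ-++ xs ys)) (sym (+-assoc x (sumℤ xs) (sumℤ ys)))

sumℤ-filter : ∀ {A : Set} {P : A → Set} (P? : Decidable P) (h : A → ℤ) xs →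
  sumℤ (map h (filter P? xs)) ≡ sumℤ (map (λ x → if does (P? x) then h x else 0ℤ) xs)
sumℤ-filter P? h [] = refl
sumℤ-filter P? h (x ∷ xs) with does (P? x)
... | true  = cong (_+_ (h x)) (sumℤ-filter P? h xs)
... | false = trans (sumℤ-filter P? h xs) (sym (+-identityˡ _))

sumℤ-allSubsets : ∀ n (h : Subset n → ℤ) → sumℤ (map h (allSubsets n)) ≡ ∑ n h
sumℤ-allSubsets zero    h = +-identityʳ (h [])
sumℤ-allSubsets (suc n) h = begin
  sumℤ (map h (map (outside ∷_) ss ++ map (inside ∷_) ss))
    ≡⟨ cong sumℤ (map-++ h (map (outside ∷_) ss) (map (inside ∷_) ss)) ⟩
  sumℤ (map h (map (outside ∷_) ss) ++ map h (map (inside ∷_) ss))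
    ≡⟨ sumℤ-++ (map h (map (outside ∷_) ss)) (map h (map (inside ∷_) ss)) ⟩
  sumℤ (map h (map (outside ∷_) ss)) + sumℤ (map h (map (inside ∷_) ss))
    ≡⟨ cong₂ _+_ (half outside) (half inside) ⟩
  ∑ (suc n) h ∎
  where
  open ≡-Reasoning
  ss = allSubsets n
  half : ∀ s → sumℤ (map h (map (s ∷_) ss)) ≡ ∑ n (λ S → h (s ∷ S))
  half s = trans (cong sumℤ (sym (map-∘ ss))) (sumℤ-allSubsets n (λ S → h (s ∷ S)))

∑-cong : ∀ n {h h′ : Subset n → ℤ} → (∀ S → h S ≡ h′ S) → ∑ n h ≡ ∑ n h′
∑-cong zero    h≗h′ = h≗h′ []
∑-cong (suc n) h≗h′ = cong₂ _+_ (∑-cong n (h≗h′ ∘ (outside ∷_))) (∑-cong n (h≗h′ ∘ (inside ∷_)))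

∑-zero : ∀ n → ∑ n (λ _ → 0ℤ) ≡ 0ℤ
∑-zero zero    = refl
∑-zero (suc n) = cong₂ _+_ (∑-zero n) (∑-zero n)

∑-+ : ∀ n (h h′ : Subset n → ℤ) → ∑ n (λ S → h S + h′ S) ≡ ∑ n h + ∑ n h′
∑-+ zero    h h′ = refl
∑-+ (suc n) h h′ =
  trans (cong₂ _+_ (∑-+ n (h ∘ (outside ∷_)) (h′ ∘ (outside ∷_))) (∑-+ n (h ∘ (inside ∷_)) (h′ ∘ (inside ∷_))))
        (interchange +-commutativeSemigroup (∑ n (h ∘ (outside ∷_))) (∑ n (h′ ∘ (outside ∷_)))
                                            (∑ n (h ∘ (inside ∷_))) (∑ n (h′ ∘ (inside ∷_))))

∑-*ˡ : ∀ n x (h : Subset n → ℤ) → ∑ n (λ S → x * h S) ≡ x * ∑ n h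
∑-*ˡ zero    x h = refl
∑-*ˡ (suc n) x h =
  trans (cong₂ _+_ (∑-*ˡ n x (h ∘ (outside ∷_))) (∑-*ˡ n x (h ∘ (inside ∷_))))
        (sym (*-distribˡ-+ x _ _))

-- Each subset not containing v is paired with the subset obtained by adding v.
∑-split : ∀ n (v : Fin n) (h : Subset n → ℤ) →
  ∑ n h ≡ ∑ n (λ S → if does (v ∈? S) then 0ℤ else h S + h (S [ v ]≔ inside))
∑-split (suc n) zero h =
  trans (sym (+-identityʳ _)) (cong₂ _+_ (sym (∑-+ n _ _)) (sym (∑-zero n)))
∑-split (suc n) (suc v) h = cong₂ _+_ (∑-split n v _) (∑-split n v _)

∑-only-⊥ : ∀ n (h : Subset n → ℤ) → (∀ S → Nonempty S → h S ≡ 0ℤ) → ∑ n h ≡ h ⊥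
∑-only-⊥ zero    h h≡0 = refl
∑-only-⊥ (suc n) h h≡0 = begin
  ∑ n (λ S → h (outside ∷ S)) + ∑ n (λ S → h (inside ∷ S))
    ≡⟨ cong₂ _+_ (∑-only-⊥ n _ λ { S (x , x∈S) → h≡0 _ (suc x , there x∈S) })
                 (∑-cong n λ S → h≡0 _ (zero , here)) ⟩
  h ⊥ + ∑ n (λ _ → 0ℤ)
    ≡⟨ trans (cong (_+_ (h ⊥)) (∑-zero n)) (+-identityʳ (h ⊥)) ⟩
  h ⊥ ∎
  where open ≡-Reasoning

x∈p─q⇒x∉q : ∀ {x : Fin n} (p q : Subset n) → x ∈ p ─ q → x ∉ q
x∈p─q⇒x∉q (inside ∷ p) (outside ∷ q) here      ()
x∈p─q⇒x∉q (s ∷ p)      (t ∷ q)       (there x∈) (there x∈q) = x∈p─q⇒x∉q p q x∈ x∈q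

x∈p-y⇒x≢y : ∀ {x y : Fin n} (p : Subset n) → x ∈ p - y → x ≢ y
x∈p-y⇒x≢y {x = x} p x∈ refl = x∈p─q⇒x∉q p ⁅ x ⁆ x∈ (x∈⁅x⁆ x)

⊤─p≡∁p : ∀ (p : Subset n) → ⊤ ─ p ≡ ∁ p
⊤─p≡∁p []            = refl
⊤─p≡∁p (inside ∷ p)  = cong (outside ∷_) (⊤─p≡∁p p)
⊤─p≡∁p (outside ∷ p) = cong (inside ∷_) (⊤─p≡∁p p)

⊆-insert : ∀ (S : Subset n) v → S ⊆ S [ v ]≔ inside
⊆-insert S v {x} x∈S with x ≟ v
... | yes refl = []≔-updates S v
... | no  x≢v  = []≔-minimal S x v x≢v x∈S

∈-insert⁻ : ∀ (S : Subset n) v {x} → x ∈ S [ v ]≔ inside → x ≡ v ⊎ x ∈ S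
∈-insert⁻ S v {x} x∈ with x ≟ v
... | yes x≡v = inj₁ x≡v
... | no  x≢v = inj₂ (lookup⇒[]= x S (trans (sym (lookup∘update′ x≢v S inside)) ([]=⇒lookup x∈)))

∣insert∣ : ∀ (S : Subset n) {v} → v ∉ S → ∣ S [ v ]≔ inside ∣ ≡ suc ∣ S ∣
∣insert∣ (outside ∷ S) {zero}  _   = refl
∣insert∣ (inside  ∷ S) {zero}  v∉S = contradiction here v∉S
∣insert∣ (outside ∷ S) {suc v} v∉S = ∣insert∣ S (v∉S ∘ there)
∣insert∣ (inside  ∷ S) {suc v} v∉S = cong suc (∣insert∣ S (v∉S ∘ there))

does-⇔ : ∀ {P Q : Set} → P ⇔ Q → (P? : Dec P) (Q? : Dec Q) → does P? ≡ does Q?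
does-⇔ P⇔Q P? (yes q) = dec-true P? (Equivalence.from P⇔Q q)
does-⇔ P⇔Q P? (no ¬q) = dec-false P? (¬q ∘ Equivalence.to P⇔Q)

*-if : ∀ x b (y : ℤ) → x * (if b then y else 0ℤ) ≡ (if b then x * y else 0ℤ)
*-if x true  y = refl
*-if x false y = *-zeroʳ x

data IsSign : ℤ → Set where
  neg : IsSign -1ℤ
  zer : IsSign 0ℤ
  pos : IsSign 1ℤ

IsSign-neg : ∀ {a} → IsSign a → IsSign (- a)
IsSign-neg neg = pos
IsSign-neg zer = zer
IsSign-neg pos = neg

ZeroOrOne : ℤ → Set
ZeroOrOne a = a ≡ 0ℤ ⊎ a ≡ 1ℤ

-- opposite nonzero signs of a and b would force |c| = 2, and those of c and a |b| = 2
IsSign-products : ∀ {a b c} → IsSign a → IsSign b → c ≡ a + - b → IsSign c →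
  ZeroOrOne (a * b) × ZeroOrOne (c * a)
IsSign-products neg neg refl zer = inj₂ refl , inj₁ refl
IsSign-products neg zer refl neg = inj₁ refl , inj₂ refl
IsSign-products neg pos refl ()
IsSign-products zer neg refl pos = inj₁ refl , inj₁ refl
IsSign-products zer zer refl zer = inj₁ refl , inj₁ refl
IsSign-products zer pos refl neg = inj₁ refl , inj₁ refl
IsSign-products pos neg refl ()
IsSign-products pos zer refl pos = inj₁ refl , inj₂ refl
IsSign-products pos pos refl zer = inj₂ refl , inj₁ refl

-- Stable sets and the vertex-deletion recurrence

module _ (G : Graph n) where

  adj-sym : ∀ {u v} → Adj G u v → Adj G v u
  adj-sym {u} {v} uv = trans (Graph.sym G v u) uv

  ¬adj-refl : ∀ {v} → ¬ Adj G v v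
  ¬adj-refl {v} vv with trans (sym vv) (irrefl G v)
  ... | ()

  ∈-closedNbhd⁺ : ∀ {v x} → x ≡ v ⊎ Adj G v x → x ∈ closedNbhd G v
  ∈-closedNbhd⁺ {v} {x} x∼v = lookup⇒[]= x (closedNbhd G v) (trans (lookup∘tabulate _ x) (holds x∼v))
    where
    holds : x ≡ v ⊎ Adj G v x → (⌊ x ≟ v ⌋ ∨ adj G v x) ≡ true
    holds x≡v⊎vx with x ≟ v | x≡v⊎vx
    ... | yes _   | _        = refl
    ... | no  x≢v | inj₁ x≡v = contradiction x≡v x≢v
    ... | no  _   | inj₂ vx  = vx

  ∈-closedNbhd⁻ : ∀ {v x} → x ∈ closedNbhd G v → x ≡ v ⊎ Adj G v x
  ∈-closedNbhd⁻ {v} {x} x∈N with x ≟ v | trans (sym (lookup∘tabulate (λ u → ⌊ u ≟ v ⌋ ∨ adj G v u) x)) ([]=⇒lookup x∈N)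
  ... | yes x≡v | _  = inj₁ x≡v
  ... | no  _   | vx = inj₂ vx

  StableIn : Subset n → Subset n → Set
  StableIn U S = S ⊆ U × Stable G S

  stableIn? : ∀ U S → Dec (StableIn U S)
  stableIn? U S = (S ⊆? U) ×-dec Stable? G S

  weight : ℤ → Subset n → Subset n → ℤ
  weight x U S = if does (stableIn? U S) then x ^ ∣ S ∣ else 0ℤ

  indPolyOn≡∑weight : ∀ U x → indPolyOn G U x ≡ ∑ n (weight x U)
  indPolyOn≡∑weight U x =
    trans (sumℤ-filter (stableIn? U) (λ S → x ^ ∣ S ∣) (allSubsets n)) (sumℤ-allSubsets n (weight x U))

  weight-cong : ∀ {x U U′ S} → StableIn U S ⇔ StableIn U′ S → weight x U S ≡ weight x U′ S
  weight-cong {x} {U} {U′} {S} S⇔S =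
    cong (λ b → if b then x ^ ∣ S ∣ else 0ℤ) (does-⇔ S⇔S (stableIn? U S) (stableIn? U′ S))

  weight-¬ : ∀ {x U S} → ¬ StableIn U S → weight x U S ≡ 0ℤ
  weight-¬ {x} {U} {S} ¬S = cong (λ b → if b then x ^ ∣ S ∣ else 0ℤ) (dec-false (stableIn? U S) ¬S)

  stableIn-remove : ∀ {U S v} → v ∉ S → StableIn U S ⇔ StableIn (U - v) S
  stableIn-remove {U} {S} {v} v∉S = mk⇔
    (λ (S⊆U , st) → (λ x∈S → x∈p∧x∉q⇒x∈p─q (S⊆U x∈S) (λ x∈v → v∉S (subst (_∈ S) (x∈⁅y⁆⇒x≡y v x∈v) x∈S))) , st)
    (λ (S⊆U-v , st) → p─q⊆p U ⁅ v ⁆ ∘ S⊆U-v , st)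

  ¬stableIn-remove : ∀ {U S v} → v ∈ S → ¬ StableIn (U - v) S
  ¬stableIn-remove {U} v∈S (S⊆U-v , _) = x∈p-y⇒x≢y U (S⊆U-v v∈S) refl

  ¬stableIn-─closedNbhd : ∀ {U S v} → v ∈ S → ¬ StableIn (U ─ closedNbhd G v) S
  ¬stableIn-─closedNbhd {U} {v = v} v∈S (S⊆ , _) =
    x∈p─q⇒x∉q U (closedNbhd G v) (S⊆ v∈S) (∈-closedNbhd⁺ (inj₁ refl))

  stableIn-insert : ∀ {U S v} → v ∈ U → v ∉ S →
    StableIn U (S [ v ]≔ inside) ⇔ StableIn (U ─ closedNbhd G v) S
  stableIn-insert {U} {S} {v} v∈U v∉S = mk⇔ to from
    where
    S+v = S [ v ]≔ inside
    v∈S+v : v ∈ S+v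
    v∈S+v = []≔-updates S v

    to : StableIn U S+v → StableIn (U ─ closedNbhd G v) S
    to (S+v⊆U , st) = S⊆ , (λ a b a∈S b∈S → st a b (⊆-insert S v a∈S) (⊆-insert S v b∈S))
      where
      S⊆ : S ⊆ U ─ closedNbhd G v
      S⊆ {x} x∈S = x∈p∧x∉q⇒x∈p─q (S+v⊆U (⊆-insert S v x∈S)) λ x∈N →
        [ (λ { refl → v∉S x∈S }) , st v x v∈S+v (⊆-insert S v x∈S) ]′ (∈-closedNbhd⁻ x∈N)

    from : StableIn (U ─ closedNbhd G v) S → StableIn U S+v
    from (S⊆ , st) = S+v⊆U , st′
      where
      ¬adj-v : ∀ {x} → x ∈ S → ¬ Adj G v x
      ¬adj-v x∈S vx = x∈p─q⇒x∉q U (closedNbhd G v) (S⊆ x∈S) (∈-closedNbhd⁺ (inj₂ vx))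
      S+v⊆U : S+v ⊆ U
      S+v⊆U x∈ with ∈-insert⁻ S v x∈
      ... | inj₁ refl = v∈U
      ... | inj₂ x∈S  = p─q⊆p U (closedNbhd G v) (S⊆ x∈S)
      st′ : Stable G S+v
      st′ a b a∈ b∈ with ∈-insert⁻ S v a∈ | ∈-insert⁻ S v b∈
      ... | inj₁ refl | inj₁ refl = ¬adj-refl
      ... | inj₁ refl | inj₂ b∈S  = ¬adj-v b∈S
      ... | inj₂ a∈S  | inj₁ refl = ¬adj-v a∈S ∘ adj-sym
      ... | inj₂ a∈S  | inj₂ b∈S  = st a b a∈S b∈S

  weight-insert : ∀ {x U S v} → v ∈ U → v ∉ S →
    weight x U (S [ v ]≔ inside) ≡ x * weight x (U ─ closedNbhd G v) S
  weight-insert {x} {U} {S} {v} v∈U v∉S = begin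
    weight x U (S [ v ]≔ inside)
      ≡⟨ cong (λ b → if b then x ^ ∣ S [ v ]≔ inside ∣ else 0ℤ)
              (does-⇔ (stableIn-insert v∈U v∉S) (stableIn? U _) (stableIn? (U ─ closedNbhd G v) S)) ⟩
    (if does (stableIn? (U ─ closedNbhd G v) S) then x ^ ∣ S [ v ]≔ inside ∣ else 0ℤ)
      ≡⟨ cong (λ k → if does (stableIn? (U ─ closedNbhd G v) S) then x ^ k else 0ℤ) (∣insert∣ S v∉S) ⟩
    (if does (stableIn? (U ─ closedNbhd G v) S) then x * x ^ ∣ S ∣ else 0ℤ)
      ≡⟨ *-if x (does (stableIn? (U ─ closedNbhd G v) S)) (x ^ ∣ S ∣) ⟨
    x * weight x (U ─ closedNbhd G v) S ∎
    where open ≡-Reasoning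

  indPolyOn-delete : ∀ {U v} x → v ∈ U →
    indPolyOn G U x ≡ indPolyOn G (U - v) x + x * indPolyOn G (U ─ closedNbhd G v) x
  indPolyOn-delete {U} {v} x v∈U = begin
    indPolyOn G U x
      ≡⟨ indPolyOn≡∑weight U x ⟩
    ∑ n (weight x U)
      ≡⟨ ∑-split n v (weight x U) ⟩
    ∑ n (λ S → if does (v ∈? S) then 0ℤ else weight x U S + weight x U (S [ v ]≔ inside))
      ≡⟨ ∑-cong n pair ⟩
    ∑ n (λ S → weight x (U - v) S + x * weight x (U ─ closedNbhd G v) S)
      ≡⟨ ∑-+ n (weight x (U - v)) (λ S → x * weight x (U ─ closedNbhd G v) S) ⟩
    ∑ n (weight x (U - v)) + ∑ n (λ S → x * weight x (U ─ closedNbhd G v) S)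
      ≡⟨ cong (_+_ (∑ n (weight x (U - v)))) (∑-*ˡ n x (weight x (U ─ closedNbhd G v))) ⟩
    ∑ n (weight x (U - v)) + x * ∑ n (weight x (U ─ closedNbhd G v))
      ≡⟨ cong₂ (λ a b → a + x * b) (indPolyOn≡∑weight (U - v) x) (indPolyOn≡∑weight (U ─ closedNbhd G v) x) ⟨
    indPolyOn G (U - v) x + x * indPolyOn G (U ─ closedNbhd G v) x ∎
    where
    open ≡-Reasoning
    pair : ∀ S → (if does (v ∈? S) then 0ℤ else weight x U S + weight x U (S [ v ]≔ inside))
               ≡ weight x (U - v) S + x * weight x (U ─ closedNbhd G v) S
    pair S with v ∈? S
    ... | yes v∈S = sym (trans
      (cong₂ (λ a b → a + x * b) (weight-¬ (¬stableIn-remove v∈S)) (weight-¬ (¬stableIn-─closedNbhd v∈S)))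
      (cong (_+_ 0ℤ) (*-zeroʳ x)))
    ... | no  v∉S = cong₂ _+_ (weight-cong (stableIn-remove v∉S)) (weight-insert v∈U v∉S)

  indPolyOn-⊥ : ∀ x → indPolyOn G ⊥ x ≡ 1ℤ
  indPolyOn-⊥ x = begin
    indPolyOn G ⊥ x   ≡⟨ indPolyOn≡∑weight ⊥ x ⟩
    ∑ n (weight x ⊥)  ≡⟨ ∑-only-⊥ n (weight x ⊥) (λ { S (y , y∈S) → weight-¬ λ (S⊆⊥ , _) → ∉⊥ (S⊆⊥ y∈S) }) ⟩
    weight x ⊥ ⊥      ≡⟨ cong (λ b → if b then x ^ ∣ ⊥ {n} ∣ else 0ℤ) (dec-true (stableIn? ⊥ ⊥) (⊥⊆ , λ a _ a∈⊥ → contradiction a∈⊥ ∉⊥)) ⟩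
    x ^ ∣ ⊥ {n} ∣     ≡⟨ cong (x ^_) (∣⊥∣≡0 n) ⟩
    1ℤ ∎
    where open ≡-Reasoning

  -- Paths in acyclic graphs

  -- paths are extended at vertex zero
  record Path (k : ℕ) : Set where
    field
      vertex    : Fin (suc k) → Fin n
      injective : Injective _≡_ _≡_ vertex
      linked    : ∀ (i : Fin k) → Adj G (vertex (inject₁ i)) (vertex (suc i))

    head : Fin n
    head = vertex zero

  open Path

  path-length< : Path k → suc k ≤ n
  path-length< p = injective⇒≤ (injective p)

  single : Fin n → Path 0
  single u = record { vertex = λ _ → u ; injective = λ { {zero} {zero} _ → refl } ; linked = λ () }

  extend : (p : Path k) (z : Fin n) → (∀ i → z ≢ vertex p i) → Adj G (head p) z → Path (suc k)
  extend {k} p z z∉p hz = record { vertex = vertex′ ; injective = injective′ ; linked = linked′ }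
    where
    vertex′ : Fin (suc (suc k)) → Fin n
    vertex′ zero    = z
    vertex′ (suc i) = vertex p i
    injective′ : Injective _≡_ _≡_ vertex′
    injective′ {zero}  {zero}  _ = refl
    injective′ {zero}  {suc j} e = contradiction e (z∉p j)
    injective′ {suc i} {zero}  e = contradiction (sym e) (z∉p i)
    injective′ {suc i} {suc j} e = cong suc (injective p e)
    linked′ : ∀ (i : Fin (suc k)) → Adj G (vertex′ (inject₁ i)) (vertex′ (suc i))
    linked′ zero    = adj-sym hz
    linked′ (suc i) = linked p i

  prefix : (p : Path k) (j : Fin (suc k)) → Path (toℕ j)
  prefix {k} p j = record
    { vertex    = vertex p ∘ ι
    ; injective = inject≤-injective _ _ _ _ ∘ injective p
    ; linked    = λ i → subst (λ t → Adj G (vertex p t) (vertex p (ι (suc i))))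
                              (inject₁∘inject≤ i) (linked p (inject≤ i j≤k))
    }
    where
    j≤k : toℕ j ≤ k
    j≤k = toℕ≤pred[n] j
    ι : Fin (suc (toℕ j)) → Fin (suc k)
    ι i = inject≤ i (toℕ<n j)
    inject₁∘inject≤ : ∀ i → inject₁ (inject≤ i j≤k) ≡ ι (inject₁ i)
    inject₁∘inject≤ i = toℕ-injective (begin
      toℕ (inject₁ (inject≤ i j≤k)) ≡⟨ toℕ-inject₁ _ ⟩
      toℕ (inject≤ i j≤k)           ≡⟨ toℕ-inject≤ i j≤k ⟩
      toℕ i                         ≡⟨ toℕ-inject₁ i ⟨
      toℕ (inject₁ i)               ≡⟨ toℕ-inject≤ (inject₁ i) (toℕ<n j) ⟨
      toℕ (ι (inject₁ i))           ∎)
      where open ≡-Reasoning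

  acyclic⇒¬closing : Acyclic G → ∀ {m} (p : Path (suc (suc m))) →
    ¬ Adj G (vertex p (fromℕ (suc (suc m)))) (head p)
  acyclic⇒¬closing ac {m} p closing = ac m (vertex p) (injective p , linked p , closing)

  acyclic⇒¬chord : Acyclic G → (p : Path (suc (suc k))) (j : Fin (suc k)) →
    ¬ Adj G (head p) (vertex p (suc (suc j)))
  acyclic⇒¬chord ac p j chord =
    acyclic⇒¬closing ac (prefix p (suc (suc j))) (subst (λ t → Adj G (vertex p t) (head p)) last≡ (adj-sym chord))
    where
    last≡ : suc (suc j) ≡ inject≤ (fromℕ (toℕ (suc (suc j)))) (toℕ<n (suc (suc j)))
    last≡ = toℕ-injective (sym (trans
      (toℕ-inject≤ (fromℕ (toℕ (suc (suc j)))) (toℕ<n (suc (suc j))))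
      (toℕ-fromℕ (toℕ (suc (suc j))))))

  acyclic⇒offPath : Acyclic G → (p : Path (suc k)) → ∀ {z} → Adj G (head p) z →
    z ≢ vertex p (suc zero) → ∀ i → z ≢ vertex p i
  acyclic⇒offPath         ac p hz _    zero          refl = ¬adj-refl hz
  acyclic⇒offPath         ac p hz z≢p₁ (suc zero)         = z≢p₁
  acyclic⇒offPath {suc k} ac p hz _    (suc (suc j)) refl = acyclic⇒¬chord ac p j hz

  DegreeAtMostOneIn : Subset n → Fin n → Set
  DegreeAtMostOneIn U u = ∀ {a b} → a ∈ U → b ∈ U → Adj G u a → Adj G u b → a ≡ b

  TwoNeighboursIn : Subset n → Fin n → Set
  TwoNeighboursIn U u = ∃₂ λ a b → a ∈ U × b ∈ U × Adj G u a × Adj G u b × a ≢ b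

  twoNeighboursIn? : ∀ U u → Dec (TwoNeighboursIn U u)
  twoNeighboursIn? U u = any? λ a → any? λ b →
    (a ∈? U) ×-dec (b ∈? U) ×-dec Adj? G u a ×-dec Adj? G u b ×-dec ¬? (a ≟ b)

  ¬two⇒degreeAtMostOne : ∀ {U u} → ¬ TwoNeighboursIn U u → DegreeAtMostOneIn U u
  ¬two⇒degreeAtMostOne ¬two {a} {b} a∈U b∈U ua ub with a ≟ b
  ... | yes a≡b = a≡b
  ... | no  a≢b = contradiction (a , b , a∈U , b∈U , ua , ub , a≢b) ¬two

  freshNeighbourIn : Acyclic G → ∀ U (p : Path k) → TwoNeighboursIn U (head p) →
    ∃ λ z → z ∈ U × Adj G (head p) z × (∀ i → z ≢ vertex p i)
  freshNeighbourIn {zero}  ac U p (a , _ , a∈U , _ , ha , _) = a , a∈U , ha , λ { zero refl → ¬adj-refl ha }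
  freshNeighbourIn {suc k} ac U p (a , b , a∈U , b∈U , ha , hb , a≢b) with a ≟ vertex p (suc zero)
  ... | yes refl = b , b∈U , hb , acyclic⇒offPath ac p hb (a≢b ∘ sym)
  ... | no  a≢p₁ = a , a∈U , ha , acyclic⇒offPath ac p ha a≢p₁

  -- Walk away from a vertex of U for as long as the current end has a second
  -- neighbour in U; acyclicity keeps the walk a path, so it stops within n steps.
  acyclic⇒degreeAtMostOneIn : Acyclic G → ∀ U → Nonempty U → ∃ λ u → u ∈ U × DegreeAtMostOneIn U u
  acyclic⇒degreeAtMostOneIn ac U (u₀ , u₀∈U) = walk n (single u₀) u₀∈U (m≤m+n n 0)
    where
    walk : ∀ d {k} (p : Path k) → head p ∈ U → n ≤ d +ℕ k → ∃ λ u → u ∈ U × DegreeAtMostOneIn U u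
    walk zero    p _ n≤k = contradiction n≤k (<⇒≱ (path-length< p))
    walk (suc d) {k} p h∈U n≤d+k with twoNeighboursIn? U (head p)
    ... | no  ¬two = head p , h∈U , ¬two⇒degreeAtMostOne ¬two
    ... | yes two with freshNeighbourIn ac U p two
    ...   | z , z∈U , hz , z∉p = walk d (extend p z z∉p hz) z∈U (subst (n ≤_) (sym (+-suc d k)) n≤d+k)

  -- The independence polynomial of a forest at −1

  ─closedNbhd-isolated : ∀ {U u} → (∀ {w} → w ∈ U → ¬ Adj G u w) → U ─ closedNbhd G u ≡ U - u
  ─closedNbhd-isolated {U} {u} isolated = ⊆-antisym
    (λ x∈ → x∈p∧x≢y⇒x∈p-y (p─q⊆p U _ x∈) λ { refl → x∈p─q⇒x∉q U _ x∈ (∈-closedNbhd⁺ (inj₁ refl)) })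
    (λ x∈ → x∈p∧x∉q⇒x∈p─q (p─q⊆p U _ x∈) λ x∈N →
      [ x∈p-y⇒x≢y U x∈ , isolated (p─q⊆p U _ x∈) ]′ (∈-closedNbhd⁻ x∈N))

  ─closedNbhd-pendant : ∀ {U u w} → w ∈ U → Adj G u w → DegreeAtMostOneIn U u →
    U ─ closedNbhd G u ≡ U - u - w
  ─closedNbhd-pendant {U} {u} {w} w∈U uw deg≤1 = ⊆-antisym
    (λ x∈ → let x∈U = p─q⊆p U _ x∈ ; x∉N = x∈p─q⇒x∉q U _ x∈ in
      x∈p∧x≢y⇒x∈p-y (x∈p∧x≢y⇒x∈p-y x∈U λ { refl → x∉N (∈-closedNbhd⁺ (inj₁ refl)) })
                    λ { refl → x∉N (∈-closedNbhd⁺ (inj₂ uw)) })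
    (λ x∈ → let x∈U-u = p─q⊆p (U - u) _ x∈ ; x∈U = p─q⊆p U _ x∈U-u in
      x∈p∧x∉q⇒x∈p─q x∈U λ x∈N →
        [ x∈p-y⇒x≢y U x∈U-u , (λ ux → x∈p-y⇒x≢y (U - u) x∈ (deg≤1 x∈U w∈U ux uw)) ]′ (∈-closedNbhd⁻ x∈N))

  indPolyOn-isolated : ∀ {U u} x → u ∈ U → (∀ {w} → w ∈ U → ¬ Adj G u w) →
    indPolyOn G U x ≡ (1ℤ + x) * indPolyOn G (U - u) x
  indPolyOn-isolated {U} {u} x u∈U isolated = begin
    indPolyOn G U x
      ≡⟨ indPolyOn-delete x u∈U ⟩
    indPolyOn G (U - u) x + x * indPolyOn G (U ─ closedNbhd G u) x
      ≡⟨ cong (λ W → indPolyOn G (U - u) x + x * indPolyOn G W x) (─closedNbhd-isolated isolated) ⟩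
    indPolyOn G (U - u) x + x * indPolyOn G (U - u) x
      ≡⟨ solve 2 (λ a x → a :+ x :* a := (con 1ℤ :+ x) :* a) refl (indPolyOn G (U - u) x) x ⟩
    (1ℤ + x) * indPolyOn G (U - u) x ∎
    where open ≡-Reasoning

  indPolyOn-pendant : ∀ {U u w} x → u ∈ U → w ∈ U → Adj G u w → DegreeAtMostOneIn U u →
    indPolyOn G U x ≡ (1ℤ + x) * indPolyOn G (U - u - w) x + x * indPolyOn G (U - u ─ closedNbhd G w) x
  indPolyOn-pendant {U} {u} {w} x u∈U w∈U uw deg≤1 = begin
    indPolyOn G U x
      ≡⟨ indPolyOn-delete x u∈U ⟩
    indPolyOn G (U - u) x + x * indPolyOn G (U ─ closedNbhd G u) x
      ≡⟨ cong₂ (λ a W → a + x * indPolyOn G W x)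
               (indPolyOn-delete x (x∈p∧x≢y⇒x∈p-y w∈U λ { refl → ¬adj-refl uw }))
               (─closedNbhd-pendant w∈U uw deg≤1) ⟩
    (indPolyOn G (U - u - w) x + x * indPolyOn G (U - u ─ closedNbhd G w) x) + x * indPolyOn G (U - u - w) x
      ≡⟨ solve 3 (λ a c x → (a :+ x :* c) :+ x :* a := (con 1ℤ :+ x) :* a :+ x :* c) refl
               (indPolyOn G (U - u - w) x) (indPolyOn G (U - u ─ closedNbhd G w) x) x ⟩
    (1ℤ + x) * indPolyOn G (U - u - w) x + x * indPolyOn G (U - u ─ closedNbhd G w) x ∎
    where open ≡-Reasoning

  acyclic⇒indPolyOn-isSign : Acyclic G → ∀ U → IsSign (indPolyOn G U -1ℤ)
  acyclic⇒indPolyOn-isSign ac U = go U (⊂-wellFounded U)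
    where
    go : ∀ U → Acc _⊂_ U → IsSign (indPolyOn G U -1ℤ)
    go U (acc smaller) with nonempty? U
    ... | no empty =
      subst IsSign (sym (trans (cong (λ W → indPolyOn G W -1ℤ) (Empty-unique empty)) (indPolyOn-⊥ -1ℤ))) pos
    ... | yes nonempty with acyclic⇒degreeAtMostOneIn ac U nonempty
    ... | u , u∈U , deg≤1 with any? (λ w → (w ∈? U) ×-dec Adj? G u w)
    ... | no  ¬nbr = subst IsSign (sym (indPolyOn-isolated -1ℤ u∈U (λ w∈U uw → ¬nbr (_ , w∈U , uw)))) zer
    ... | yes (w , w∈U , uw) = subst IsSign (sym f≡-f) (IsSign-neg (go W (smaller W⊂U)))
      where
      W : Subset n
      W = U - u ─ closedNbhd G w
      W⊂U : W ⊂ U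
      W⊂U = ⊆-⊂-trans (p─q⊆p (U - u) (closedNbhd G w)) (x∈p⇒p-x⊂p u∈U)
      -- (1 + −1) · a reduces to 0
      f≡-f : indPolyOn G U -1ℤ ≡ - indPolyOn G W -1ℤ
      f≡-f = trans (indPolyOn-pendant -1ℤ u∈U w∈U uw deg≤1) (trans (+-identityˡ _) (-1*i≡-i _))

corollary2p10 : ∀ {n : ℕ} (T : Graph n) → IsTree T → 2 ≤ n → (v : Fin n) →
    ((indPolyMinus T ⁅ v ⁆ (- + 1) * indPolyMinus T (closedNbhd T v) (- + 1) ≡ + 0)
      ⊎ (indPolyMinus T ⁅ v ⁆ (- + 1) * indPolyMinus T (closedNbhd T v) (- + 1) ≡ + 1))
    × ((indPoly T (- + 1) * indPolyMinus T ⁅ v ⁆ (- + 1) ≡ + 0)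
      ⊎ (indPoly T (- + 1) * indPolyMinus T ⁅ v ⁆ (- + 1) ≡ + 1))
corollary2p10 {n} T (_ , acyclic) _ v =
  IsSign-products (isSign (∁ ⁅ v ⁆)) (isSign (∁ (closedNbhd T v))) delete-v (isSign ⊤)
  where
  open ≡-Reasoning
  I : Subset n → ℤ
  I U = indPolyOn T U -1ℤ
  isSign : ∀ U → IsSign (I U)
  isSign = acyclic⇒indPolyOn-isSign T acyclic
  delete-v : I ⊤ ≡ I (∁ ⁅ v ⁆) + - I (∁ (closedNbhd T v))
  delete-v = begin
    I ⊤                                         ≡⟨ indPolyOn-delete T -1ℤ ∈⊤ ⟩
    I (⊤ - v) + -1ℤ * I (⊤ ─ closedNbhd T v)    ≡⟨ cong₂ (λ A B → I A + -1ℤ * I B) (⊤─p≡∁p ⁅ v ⁆) (⊤─p≡∁p (closedNbhd T v)) ⟩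
    I (∁ ⁅ v ⁆) + -1ℤ * I (∁ (closedNbhd T v))  ≡⟨ cong (_+_ (I (∁ ⁅ v ⁆))) (-1*i≡-i _) ⟩
    I (∁ ⁅ v ⁆) + - I (∁ (closedNbhd T v))      ∎
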